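{- Let $n\ge1$, $m\ge1$, and let $f_d\cdots f_1$ be the word corresponding to a pivot path in the dYoke graph $Z_{n,m}$. Then for every $0\le i\le m$, the letters $\overleftarrow{s}_i$ and $\overrightarrow{s}_i$ do not both occur in $f_d\cdots f_1$.
   Context: Elements of $\mathbb{Z}_n$ are identified with their smallest nonnegative representatives in $\{0,\dots,n-1\}$. The dYoke graph $Z_{n,m}$ has as vertices all tuples $u=(u_0,\dots,u_{m+1})$ with $u_0,u_{m+1}\in\mathbb{Z}_n$, $u_1,\dots,u_m\in\{ -1,0,1\}$ and $\sum_{i=0}^{m+1}u_i\equiv0\pmod n$; adjacency: there is $0\le i\le m$ with $u_j=v_j$ for $j\notin\{i,i+1\}$ and either ($u_i=v_i+1$, $u_{i+1}=v_{i+1}-1$) or ($u_i=v_i-1$, $u_{i+1}=v_{i+1}+1$), arithmetic in coordinates $0,m+1$ in $\mathbb{Z}_n$. $0$ is the all-zero vertex. For $0\le i\le m$, $\overleftarrow{s}_i(v)$ is obtained from $v$ by adding $1$ to entry $i$ and subtracting $1$ from entry $i+1$ if the result is a vertex (and is $v$ otherwise); $\overrightarrow{s}_i(v)$ subtracts $1$ from entry $i$ and adds $1$ to entry $i+1$. The word of a path $v^0\sim\dots\sim v^d$ is $f_d\cdots f_1$ with $f_t(v^{t-1})=v^t$. For a path $P$ from $v$ to $0$ with word $w$: an integer $0\le p\le m$ is an inner wall of $P$ if neither $\overleftarrow{s}_p$ nor $\overrightarrow{s}_p$ occurs in $w$; $-1$ is a (left outer) wall if $\overleftarrow{s}_0$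 does not occur in $w$; $m+1$ is a (right outer) wall if $\overrightarrow{s}_m$ does not occur in $w$. A path $P$ from $v$ to $0$ is a $p$-pivot path of $v$ if it is a shortest path among all paths from $v$ to $0$ having $p$ as a wall; a pivot path is a $p$-pivot path for some $p$. -}

module Defs where

open import Data.Nat as ℕ using (ℕ; suc)
open import Data.Integer as ℤ using (ℤ; +_; -[1+_]; _+_; _-_; _≤_; _<_)
open import Data.Integer.Divisibility using (_∣_)
open import Data.Fin using (Fin; toℕ; inject₁; fromℕ)
open import Data.Vec using (Vec; lookup; replicate; foldr)
open import Data.List using (List; []; _∷_; length)
open import Data.List.Membership.Propositional using (_∈_; _∉_)
open import Data.Product using (_×_; _,_; ∃-syntax)
open import Data.Sum using (_⊎_)
open import Relation.Binary.PropositionalEquality using (_≡_; _≢_)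
open import Relation.Nullary using (¬_)

-- Coordinates 0 and m+1 hold the smallest nonnegative representative of an
-- element of ℤ_n; the middle coordinates are in {-1,0,1}.
Tuple : ℕ → Set
Tuple m = Vec ℤ (suc (suc m))

firstIx : (m : ℕ) → Fin (suc (suc m))
firstIx m = Data.Fin.zero

lastIx : (m : ℕ) → Fin (suc (suc m))
lastIx m = fromℕ (suc m)

IsOuter : {m : ℕ} → Fin (suc (suc m)) → Set
IsOuter {m} j = (toℕ j ≡ 0) ⊎ (toℕ j ≡ suc m)

sumV : {k : ℕ} → Vec ℤ k → ℤ
sumV = foldr _ _+_ (+ 0)

IsVertex : (n m : ℕ) → Tuple m → Set
IsVertex n m u =
  ((+ 0 ≤ lookup u (firstIx m)) × (lookup u (firstIx m) < + n)) ×
  ((+ 0 ≤ lookup u (lastIx m)) × (lookup u (lastIx m) < + n)) ×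
  (∀ (j : Fin m) → (-[1+ 0 ] ≤ lookup u (Data.Fin.suc (inject₁ j)))
                 × (lookup u (Data.Fin.suc (inject₁ j)) ≤ + 1)) ×
  ((+ n) ∣ sumV u)

zeroV : (m : ℕ) → Tuple m
zeroV m = replicate _ (+ 0)

CoordEq : (n : ℕ) {m : ℕ} → Fin (suc (suc m)) → ℤ → ℤ → Set
CoordEq n j a b = (IsOuter j × ((+ n) ∣ (a - b))) ⊎ (¬ IsOuter j × (a ≡ b))

-- letters: L i stands for s⃖_i (add 1 at i, subtract 1 at i+1),
--          R i stands for s⃗_i (subtract 1 at i, add 1 at i+1), 0 ≤ i ≤ m
data Letter (m : ℕ) : Set where
  L : Fin (suc m) → Letter m
  R : Fin (suc m) → Letter m

delta : {m : ℕ} → Letter m → ℤ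
delta (L _) = + 1
delta (R _) = -[1+ 0 ]

index : {m : ℕ} → Letter m → Fin (suc m)
index (L i) = i
index (R i) = i

Step : (n m : ℕ) → Tuple m → Letter m → Tuple m → Set
Step n m u f v =
  (∀ (j : Fin (suc (suc m))) → j ≢ inject₁ (index f) → j ≢ Data.Fin.suc (index f) →
     CoordEq n j (lookup v j) (lookup u j)) ×
  CoordEq n (inject₁ (index f)) (lookup v (inject₁ (index f)))
                               (lookup u (inject₁ (index f)) + delta f) ×
  CoordEq n (Data.Fin.suc (index f)) (lookup v (Data.Fin.suc (index f)))
                                     (lookup u (Data.Fin.suc (index f)) - delta f)

-- Path n m v w ws : a path v = v^0 ∼ v^1 ∼ … ∼ v^d = w in Z_{n,m} whose word,
-- listed in path order, is ws = f_1 , … , f_d  (f_t(v^{t-1}) = v^t).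
data Path (n m : ℕ) : Tuple m → Tuple m → List (Letter m) → Set where
  stop : {v : Tuple m} → IsVertex n m v → Path n m v v []
  step : {u v w : Tuple m} {f : Letter m} {ws : List (Letter m)} →
         IsVertex n m u → Step n m u f v → Path n m v w ws →
         Path n m u w (f ∷ ws)

data Wall (m : ℕ) (ws : List (Letter m)) : ℤ → Set where
  leftWall  : L Data.Fin.zero ∉ ws → Wall m ws -[1+ 0 ]
  innerWall : (p : Fin (suc m)) → L p ∉ ws → R p ∉ ws → Wall m ws (+ toℕ p)
  rightWall : R (fromℕ m) ∉ ws → Wall m ws (+ suc m)

IsPivotPathAt : (n m : ℕ) (v : Tuple m) (ws : List (Letter m)) →
                Path n m v (zeroV m) ws → ℤ → Set
IsPivotPathAt n m v ws P p =
  Wall m ws p ×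
  (∀ (ws' : List (Letter m)) → Path n m v (zeroV m) ws' → Wall m ws' p →
     length ws ℕ.≤ length ws')

IsPivotPath : (n m : ℕ) (v : Tuple m) (ws : List (Letter m)) →
              Path n m v (zeroV m) ws → Set
IsPivotPath n m v ws P = ∃[ p ] IsPivotPathAt n m v ws P p

module Submission where

-- Read the word of a path P from v to 0 as a flow x on the edges, x_i =
-- #s⃖_i − #s⃗_i.  Every coordinate c of v is then congruent (mod n at the
-- outer coordinates, exactly in the middle) to the divergence x_{c−1} − x_c:
-- v is "balanced" by x.  Conversely, from any vertex balanced by x, a greedy
-- descent that always moves across an edge where x is extremal, in the
-- direction of x, reaches 0 in Σ|x_i| steps and uses s⃖_i only where x_i > 0
-- and s⃗_i only where x_i < 0; hence it keeps every wall of P.  If P used both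
-- s⃖_i and s⃗_i, then Σ|x_i| ≤ |P| − 2, so the greedy path would be a shorter
-- path with the same wall, contradicting minimality.

open import Defs
open import Data.Nat as ℕ using (ℕ; zero; suc; z≤n; s≤s; NonZero)
import Data.Nat.Properties as ℕP
import Data.Nat.Divisibility as ℕD
open import Data.Integer as ℤ using (ℤ; +_; -[1+_]; _+_; _-_; -_; _*_; ∣_∣; _≤_; _<_; +≤+; -≤+; -≤-; +<+)
import Data.Integer.Properties as ℤP
open import Data.Integer.Divisibility.Signed using (_∣_; divides; ∣ᵤ⇒∣; ∣⇒∣ᵤ; ∣-refl; ∣m∣n⇒∣m+n; ∣m⇒∣-m; ∣n⇒∣m*n)
open import Data.Integer.DivMod using (_%ℕ_; _/ℕ_; a≡a%ℕn+[a/ℕn]*n; n%ℕd<d)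
open import Data.Integer.Tactic.RingSolver using (solve-∀)
open import Data.Fin as Fin using (Fin; toℕ; inject₁; fromℕ)
import Data.Fin.Properties as FinP
open import Data.Fin.Relation.Unary.Top using (view; ‵fromℕ; ‵inject₁)
open import Data.Vec using (Vec; []; _∷_; lookup; _[_]≔_)
import Data.Vec.Properties as VecP
open import Data.List using (List; []; _∷_; length)
open import Data.List.Membership.Propositional using (_∈_; _∉_)
open import Data.List.Relation.Unary.Any using (here; there)
open import Data.List.Relation.Unary.All as All using (All; []; _∷_)
open import Data.Product using (_×_; _,_; proj₁; proj₂; Σ-syntax)
open import Data.Sum using (_⊎_; inj₁; inj₂; [_,_])
open import Data.Empty using (⊥-elim)
open import Function using (_∘_)
open import Relation.Binary.Definitions using (DecidableEquality)
open import Relation.Binary.PropositionalEquality using (_≡_; _≢_; refl; sym; trans; cong; cong₂; subst; module ≡-Reasoning)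
open import Relation.Nullary using (¬_; Dec; yes; no)

total : ∀ {k} → (Fin k → ℕ) → ℕ
total {zero}  g = 0
total {suc k} g = g Fin.zero ℕ.+ total (g ∘ Fin.suc)

total-cong : ∀ {k} {g h : Fin k → ℕ} → (∀ i → g i ≡ h i) → total g ≡ total h
total-cong {zero}  eq = refl
total-cong {suc k} eq = cong₂ ℕ._+_ (eq Fin.zero) (total-cong (eq ∘ Fin.suc))

total-vanish : ∀ {k} (g : Fin k → ℕ) → (∀ i → g i ≡ 0) → total g ≡ 0
total-vanish {zero}  g z = refl
total-vanish {suc k} g z = cong₂ ℕ._+_ (z Fin.zero) (total-vanish (g ∘ Fin.suc) (z ∘ Fin.suc))

total-step : ∀ {k} (g h : Fin k → ℕ) i → g i ≡ suc (h i) → (∀ j → j ≢ i → g j ≡ h j) →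
             total g ≡ suc (total h)
total-step g h Fin.zero    at off = cong₂ ℕ._+_ at (total-cong (λ j → off (Fin.suc j) (λ ())))
total-step g h (Fin.suc i) at off =
  trans (cong₂ ℕ._+_ (off Fin.zero (λ ()))
                     (total-step (g ∘ Fin.suc) (h ∘ Fin.suc) i at
                                 (λ j j≢i → off (Fin.suc j) (j≢i ∘ FinP.suc-injective))))
        (ℕP.+-suc (h Fin.zero) _)

total-mono : ∀ {k} (g h : Fin k → ℕ) → (∀ i → g i ℕ.≤ h i) → total g ℕ.≤ total h
total-mono {zero}  g h le = z≤n
total-mono {suc k} g h le = ℕP.+-mono-≤ (le Fin.zero) (total-mono (g ∘ Fin.suc) (h ∘ Fin.suc) (le ∘ Fin.suc))

total-gap : ∀ {k} (g h : Fin k → ℕ) i → (∀ j → g j ℕ.≤ h j) → 2 ℕ.+ g i ℕ.≤ h i →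
            2 ℕ.+ total g ℕ.≤ total h
total-gap g h Fin.zero    le gap = ℕP.+-mono-≤ gap (total-mono (g ∘ Fin.suc) (h ∘ Fin.suc) (le ∘ Fin.suc))
total-gap g h (Fin.suc i) le gap =
  subst (ℕ._≤ total h) (move-two (g Fin.zero) _)
        (ℕP.+-mono-≤ (le Fin.zero) (total-gap (g ∘ Fin.suc) (h ∘ Fin.suc) i (le ∘ Fin.suc) gap))
  where
    move-two : ∀ a b → a ℕ.+ (2 ℕ.+ b) ≡ 2 ℕ.+ (a ℕ.+ b)
    move-two a b = trans (ℕP.+-suc a (suc b)) (cong suc (ℕP.+-suc a b))

Coord : ℕ → Set
Coord m = Fin (suc (suc m))

isOuter? : ∀ {m} (c : Coord m) → Dec (IsOuter c)
isOuter? {m} c with toℕ c ℕ.≟ 0 | toℕ c ℕ.≟ suc m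
... | yes first | _        = yes (inj₁ first)
... | no _      | yes last = yes (inj₂ last)
... | no ¬first | no ¬last = no [ ¬first , ¬last ]

middle-not-outer : ∀ {m} (j : Fin m) → ¬ IsOuter {m} (Fin.suc (inject₁ j))
middle-not-outer j (inj₁ ())
middle-not-outer j (inj₂ e) = FinP.toℕ-inject₁-≢ j (sym (ℕP.suc-injective e))

last-outer : ∀ {m} → IsOuter {m} (fromℕ (suc m))
last-outer {m} = inj₂ (FinP.toℕ-fromℕ (suc m))

inject₁≢suc : ∀ {k} (i : Fin k) → inject₁ i ≢ Fin.suc i
inject₁≢suc Fin.zero    ()
inject₁≢suc (Fin.suc i) e = inject₁≢suc i (FinP.suc-injective e)

translate-diff : ∀ a b d → (a + d) - (b + d) ≡ a - b
translate-diff = solve-∀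

module _ {n m : ℕ} where

  n∣a-a : ∀ a → + n ∣ a - a
  n∣a-a a = divides (+ 0) (ℤP.+-inverseʳ a)

  ≈-map : ∀ {c : Coord m} {a b a' b'} → (+ n ∣ a - b → + n ∣ a' - b') → (a ≡ b → a' ≡ b') →
          CoordEq n c a b → CoordEq n c a' b'
  ≈-map div _  (inj₁ (o , d)) = inj₁ (o , ∣⇒∣ᵤ (div (∣ᵤ⇒∣ d)))
  ≈-map _   eq (inj₂ (o , e)) = inj₂ (o , eq e)

  ≈-reflexive : ∀ {c : Coord m} {a b} → a ≡ b → CoordEq n c a b
  ≈-reflexive {c} {a} refl with isOuter? c
  ... | yes o  = inj₁ (o , ∣⇒∣ᵤ (n∣a-a a))
  ... | no ¬o = inj₂ (¬o , refl)

  ≈-sym : ∀ {c : Coord m} {a b} → CoordEq n c a b → CoordEq n c b a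
  ≈-sym {a = a} {b} = ≈-map (λ d → subst (+ n ∣_) (negate a b) (∣m⇒∣-m d)) sym
    where
      negate : ∀ a b → - (a - b) ≡ b - a
      negate = solve-∀

  ≈-trans : ∀ {c : Coord m} {a b d} → CoordEq n c a b → CoordEq n c b d → CoordEq n c a d
  ≈-trans {a = a} {b} {d} (inj₁ (o , p)) (inj₁ (_ , q)) =
    inj₁ (o , ∣⇒∣ᵤ (subst (+ n ∣_) (telescope a b d) (∣m∣n⇒∣m+n (∣ᵤ⇒∣ {i = a - b} p) (∣ᵤ⇒∣ {i = b - d} q))))
    where
      telescope : ∀ a b d → (a - b) + (b - d) ≡ a - d
      telescope = solve-∀
  ≈-trans (inj₁ (o , _))  (inj₂ (¬o , _)) = ⊥-elim (¬o o)
  ≈-trans (inj₂ (¬o , _)) (inj₁ (o , _))  = ⊥-elim (¬o o)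
  ≈-trans (inj₂ (¬o , p)) (inj₂ (_ , q))  = inj₂ (¬o , trans p q)

  ≈-shift : ∀ {c : Coord m} {a b} d → CoordEq n c a b → CoordEq n c (a + d) (b + d)
  ≈-shift {a = a} {b} d = ≈-map (subst (+ n ∣_) (sym (translate-diff a b d))) (cong (λ y → y + d))

  ≈⇒∣ : ∀ {c : Coord m} {a b} → CoordEq n c a b → + n ∣ a - b
  ≈⇒∣ (inj₁ (_ , d))            = ∣ᵤ⇒∣ d
  ≈⇒∣ {a = a} (inj₂ (_ , refl)) = n∣a-a a

  ≈-middle : ∀ {c : Coord m} {a b} → ¬ IsOuter c → CoordEq n c a b → a ≡ b
  ≈-middle ¬o (inj₁ (o , _)) = ⊥-elim (¬o o)
  ≈-middle _  (inj₂ (_ , e)) = e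

  ≈⇒diff≈0 : ∀ {c : Coord m} {a b} → CoordEq n c a b → CoordEq n c (a - b) (+ 0)
  ≈⇒diff≈0 {b = b} e = ≈-trans (≈-shift (- b) e) (≈-reflexive (ℤP.+-inverseʳ b))

  diff≈0⇒≈ : ∀ {c : Coord m} {a b} → CoordEq n c (a - b) (+ 0) → CoordEq n c a b
  diff≈0⇒≈ {a = a} {b} e =
    ≈-trans (≈-reflexive (restore a b)) (≈-trans (≈-shift b e) (≈-reflexive (ℤP.+-identityˡ b)))
    where
      restore : ∀ a b → a ≡ (a - b) + b
      restore = solve-∀

InRange : ℤ → Set
InRange a = (-[1+ 0 ] ≤ a) × (a ≤ + 1)

Admissible : (n : ℕ) {m : ℕ} → Coord m → ℤ → Set
Admissible n c a = (IsOuter c → (+ 0 ≤ a) × (a < + n)) × (¬ IsOuter c → InRange a)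

small-multiple : ∀ {n a} → + 0 ≤ a → a < + n → + n ∣ a → a ≡ + 0
small-multiple {a = + zero}  _ _          _ = refl
small-multiple {a = + suc k} _ (+<+ k<n) d = ⊥-elim (ℕD.>⇒∤ k<n (∣⇒∣ᵤ d))

module _ {n m : ℕ} where

  vertex-admissible : ∀ {u} → IsVertex n m u → ∀ c → Admissible n c (lookup u c)
  vertex-admissible (first , _ , _ , _) Fin.zero = (λ _ → first) , (λ ¬o → ⊥-elim (¬o (inj₁ refl)))
  vertex-admissible (_ , last , middle , _) (Fin.suc c) with view c
  ... | ‵fromℕ      = (λ _ → last) , (λ ¬o → ⊥-elim (¬o last-outer))
  ... | ‵inject₁ j = (λ o → ⊥-elim (middle-not-outer j o)) , (λ _ → middle j)

  admissible-vertex : ∀ {u} → (∀ c → Admissible n c (lookup u c)) → + n ∣ sumV u → IsVertex n m u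
  admissible-vertex adm sum =
    proj₁ (adm Fin.zero) (inj₁ refl) , proj₁ (adm (fromℕ (suc m))) last-outer ,
    (λ j → proj₂ (adm (Fin.suc (inject₁ j))) (middle-not-outer j)) , ∣⇒∣ᵤ sum

  vertex-≈0 : ∀ {u} → IsVertex n m u → (∀ c → CoordEq n c (lookup u c) (+ 0)) → u ≡ zeroV m
  vertex-≈0 {u} vu ≈0 =
    trans (sym (VecP.tabulate∘lookup u))
          (trans (VecP.tabulate-cong coordinate) (VecP.tabulate∘lookup (zeroV m)))
    where
      zero-at : ∀ {c a} → Admissible n c a → CoordEq n c a (+ 0) → a ≡ + 0
      zero-at {a = a} (outer , _) (inj₁ (o , d)) =
        small-multiple (proj₁ (outer o)) (proj₂ (outer o)) (subst (+ n ∣_) (ℤP.+-identityʳ a) (∣ᵤ⇒∣ d))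
      zero-at _ (inj₂ (_ , e)) = e
      coordinate : ∀ c → lookup u c ≡ lookup (zeroV m) c
      coordinate c = trans (zero-at (vertex-admissible {u = u} vu c) (≈0 c)) (sym (VecP.lookup-replicate c (+ 0)))

module _ {n m : ℕ} {{_ : NonZero n}} where

  reduce : Coord m → ℤ → ℤ
  reduce c a with isOuter? c
  ... | yes _ = + (a %ℕ n)
  ... | no _  = a

  reduce-≈ : ∀ c a → CoordEq n c (reduce c a) a
  reduce-≈ c a with isOuter? c
  ... | yes o  = inj₁ (o , ∣⇒∣ᵤ (subst (+ n ∣_) (sym remainder) (∣m⇒∣-m (∣n⇒∣m*n (a /ℕ n) ∣-refl))))
    where
      cancel : ∀ r q → r - (r + q) ≡ - q
      cancel = solve-∀
      remainder : + (a %ℕ n) - a ≡ - ((a /ℕ n) * + n)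
      remainder = trans (cong (_-_ (+ (a %ℕ n))) (a≡a%ℕn+[a/ℕn]*n a n)) (cancel (+ (a %ℕ n)) ((a /ℕ n) * + n))
  ... | no ¬o = inj₂ (¬o , refl)

  reduce-admissible : ∀ c a → (¬ IsOuter c → InRange a) → Admissible n c (reduce c a)
  reduce-admissible c a middle with isOuter? c
  ... | yes o  = (λ _ → +≤+ z≤n , +<+ (n%ℕd<d a n)) , (λ ¬o → ⊥-elim (¬o o))
  ... | no ¬o = (λ o → ⊥-elim (¬o o)) , middle

sum-update : ∀ {k} (w : Vec ℤ k) i a → sumV (w [ i ]≔ a) ≡ sumV w + (a - lookup w i)
sum-update (b ∷ w) Fin.zero    a = exchange b (sumV w) a
  where
    exchange : ∀ b s a → a + s ≡ (b + s) + (a - b)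
    exchange = solve-∀
sum-update (b ∷ w) (Fin.suc i) a = trans (cong (_+_ b) (sum-update w i a)) (sym (ℤP.+-assoc b _ _))

module _ {k : ℕ} (u : Vec ℤ k) (c₁ c₂ : Fin k) (a₁ a₂ : ℤ) where

  update₂ : Vec ℤ k
  update₂ = (u [ c₁ ]≔ a₁) [ c₂ ]≔ a₂

  update₂-at₁ : c₁ ≢ c₂ → lookup update₂ c₁ ≡ a₁
  update₂-at₁ c₁≢c₂ = trans (VecP.lookup∘update′ c₁≢c₂ (u [ c₁ ]≔ a₁) a₂) (VecP.lookup∘update c₁ u a₁)

  update₂-at₂ : lookup update₂ c₂ ≡ a₂
  update₂-at₂ = VecP.lookup∘update c₂ (u [ c₁ ]≔ a₁) a₂

  update₂-elsewhere : ∀ c → c ≢ c₁ → c ≢ c₂ → lookup update₂ c ≡ lookup u c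
  update₂-elsewhere c ≢₁ ≢₂ = trans (VecP.lookup∘update′ ≢₂ (u [ c₁ ]≔ a₁) a₂) (VecP.lookup∘update′ ≢₁ u a₁)

  update₂-sum : c₁ ≢ c₂ → sumV update₂ ≡ sumV u + (a₁ - lookup u c₁) + (a₂ - lookup u c₂)
  update₂-sum c₁≢c₂ =
    trans (sum-update (u [ c₁ ]≔ a₁) c₂ a₂)
          (cong₂ (λ s w → s + (a₂ - w)) (sum-update u c₁ a₁) (VecP.lookup∘update′ (c₁≢c₂ ∘ sym) u a₁))

-- Flows.  A flow x assigns an integer to every edge i ∈ {0,…,m}, joining
-- coordinates i and i+1; its divergence at coordinate c is x_{c−1} − x_c,
-- where x_{−1} = x_{m+1} = 0.

Flow : ℕ → Set
Flow m = Fin (suc m) → ℤ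

inflow : ∀ {k} → (Fin k → ℤ) → Fin (suc k) → ℤ
inflow x Fin.zero    = + 0
inflow x (Fin.suc i) = x i

outflow : ∀ {k} → (Fin k → ℤ) → Fin (suc k) → ℤ
outflow {zero}  x Fin.zero    = + 0
outflow {suc k} x Fin.zero    = x Fin.zero
outflow {suc k} x (Fin.suc c) = outflow (x ∘ Fin.suc) c

outflow-inject₁ : ∀ {k} (x : Fin k → ℤ) i → outflow x (inject₁ i) ≡ x i
outflow-inject₁ x Fin.zero    = refl
outflow-inject₁ x (Fin.suc i) = outflow-inject₁ (x ∘ Fin.suc) i

outflow-last : ∀ {k} (x : Fin k → ℤ) → outflow x (fromℕ k) ≡ + 0
outflow-last {zero}  x = refl
outflow-last {suc k} x = outflow-last (x ∘ Fin.suc)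

divergence : ∀ {m} → Flow m → Coord m → ℤ
divergence x c = inflow x c - outflow x c

divergence-vanish : ∀ {m} (x : Flow m) → (∀ i → x i ≡ + 0) → ∀ c → divergence x c ≡ + 0
divergence-vanish x vanish c = cong₂ _-_ (inflow-vanish c) (outflow-vanish c)
  where
    inflow-vanish : ∀ c → inflow x c ≡ + 0
    inflow-vanish Fin.zero    = refl
    inflow-vanish (Fin.suc i) = vanish i
    outflow-vanish : ∀ c → outflow x c ≡ + 0
    outflow-vanish c with view c
    ... | ‵fromℕ      = outflow-last x
    ... | ‵inject₁ i = trans (outflow-inject₁ x i) (vanish i)

divergence-left-middle : ∀ {m} (x : Flow m) i → ¬ IsOuter (inject₁ i) →
                         Σ[ j ∈ Fin (suc m) ] divergence x (inject₁ i) ≡ x j - x i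
divergence-left-middle x Fin.zero    ¬o = ⊥-elim (¬o (inj₁ refl))
divergence-left-middle x (Fin.suc i) ¬o = inject₁ i , cong (_-_ (x (inject₁ i))) (outflow-inject₁ x (Fin.suc i))

divergence-right-middle : ∀ {m} (x : Flow m) i → ¬ IsOuter (Fin.suc i) →
                          Σ[ j ∈ Fin (suc m) ] divergence x (Fin.suc i) ≡ x i - x j
divergence-right-middle x i ¬o with view i
... | ‵fromℕ      = ⊥-elim (¬o last-outer)
... | ‵inject₁ j = Fin.suc j , cong (_-_ (x (inject₁ j))) (outflow-inject₁ (x ∘ Fin.suc) j)

Removes : ∀ {m} → Letter m → Flow m → Flow m → Set
Removes f x x' = (x' (index f) ≡ x (index f) - delta f) × (∀ j → j ≢ index f → x' j ≡ x j)

module _ {m : ℕ} {f : Letter m} {x x' : Flow m} (rem : Removes f x x') where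

  private
    i : Fin (suc m)
    i = index f
    δ : ℤ
    δ = delta f
    at : x' i ≡ x i - δ
    at = proj₁ rem
    off : ∀ j → j ≢ i → x' j ≡ x j
    off = proj₂ rem

  inflow-off : ∀ c → c ≢ Fin.suc i → inflow x' c ≡ inflow x c
  inflow-off Fin.zero    _   = refl
  inflow-off (Fin.suc j) c≢ = off j (c≢ ∘ cong Fin.suc)

  outflow-off : ∀ c → c ≢ inject₁ i → outflow x' c ≡ outflow x c
  outflow-off c c≢ with view c
  ... | ‵fromℕ      = trans (outflow-last x') (sym (outflow-last x))
  ... | ‵inject₁ j = trans (outflow-inject₁ x' j) (trans (off j (c≢ ∘ cong inject₁)) (sym (outflow-inject₁ x j)))

  divergence-left : divergence x' (inject₁ i) ≡ divergence x (inject₁ i) + δ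
  divergence-left = begin
    inflow x' (inject₁ i) - outflow x' (inject₁ i)
      ≡⟨ cong₂ _-_ (inflow-off (inject₁ i) (inject₁≢suc i)) (outflow-inject₁ x' i) ⟩
    inflow x (inject₁ i) - x' i
      ≡⟨ cong (_-_ (inflow x (inject₁ i))) at ⟩
    inflow x (inject₁ i) - (x i - δ)
      ≡⟨ regroup (inflow x (inject₁ i)) (x i) δ ⟩
    (inflow x (inject₁ i) - x i) + δ
      ≡⟨ cong (λ y → inflow x (inject₁ i) - y + δ) (sym (outflow-inject₁ x i)) ⟩
    divergence x (inject₁ i) + δ ∎
    where
      open ≡-Reasoning
      regroup : ∀ a y d → a - (y - d) ≡ (a - y) + d
      regroup = solve-∀

  divergence-right : divergence x' (Fin.suc i) ≡ divergence x (Fin.suc i) - δ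
  divergence-right = begin
    x' i - outflow x' (Fin.suc i)
      ≡⟨ cong₂ _-_ at (outflow-off (Fin.suc i) (inject₁≢suc i ∘ sym)) ⟩
    (x i - δ) - outflow x (Fin.suc i)
      ≡⟨ regroup (x i) δ (outflow x (Fin.suc i)) ⟩
    divergence x (Fin.suc i) - δ ∎
    where
      open ≡-Reasoning
      regroup : ∀ a d y → (a - d) - y ≡ (a - y) - d
      regroup = solve-∀

  divergence-off : ∀ c → c ≢ inject₁ i → c ≢ Fin.suc i → divergence x' c ≡ divergence x c
  divergence-off c ≢left ≢right = cong₂ _-_ (inflow-off c ≢right) (outflow-off c ≢left)

Balanced : (n : ℕ) {m : ℕ} → Tuple m → Flow m → Set
Balanced n u x = ∀ c → CoordEq n c (lookup u c) (divergence x c)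

module _ {n m : ℕ} {u v : Tuple m} {f : Letter m} {x x' : Flow m} where

  step-residual : Step n m u f v → Removes f x x' →
                  ∀ c → CoordEq n c (lookup u c - divergence x c) (lookup v c - divergence x' c)
  step-residual (others , left , right) rem c
    with c FinP.≟ inject₁ (index f) | c FinP.≟ Fin.suc (index f)
  ... | yes refl | _ =
    ≈-sym (≈-trans (≈-shift (- divergence x' c) left)
                   (≈-reflexive (trans (cong (_-_ (lookup u c + delta f)) (divergence-left rem))
                                       (translate-diff (lookup u c) (divergence x c) (delta f)))))
  ... | no _ | yes refl =
    ≈-sym (≈-trans (≈-shift (- divergence x' c) right)
                   (≈-reflexive (trans (cong (_-_ (lookup u c - delta f)) (divergence-right rem))
                                       (translate-diff (lookup u c) (divergence x c) (- delta f)))))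
  ... | no ≢left | no ≢right =
    ≈-sym (≈-trans (≈-shift (- divergence x' c) (others c ≢left ≢right))
                   (≈-reflexive (cong (_-_ (lookup u c)) (divergence-off rem c ≢left ≢right))))

  balanced-backward : Step n m u f v → Removes f x x' → Balanced n v x' → Balanced n u x
  balanced-backward stp rem bal c = diff≈0⇒≈ (≈-trans (step-residual stp rem c) (≈⇒diff≈0 (bal c)))

  balanced-forward : Step n m u f v → Removes f x x' → Balanced n u x → Balanced n v x'
  balanced-forward stp rem bal c = diff≈0⇒≈ (≈-trans (≈-sym (step-residual stp rem c)) (≈⇒diff≈0 (bal c)))

module _ {m : ℕ} where

  _≟ₗ_ : DecidableEquality (Letter m)
  L i ≟ₗ L j with i FinP.≟ j
  ... | yes refl = yes refl
  ... | no i≢j  = no λ { refl → i≢j refl }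
  L _ ≟ₗ R _ = no λ ()
  R _ ≟ₗ L _ = no λ ()
  R i ≟ₗ R j with i FinP.≟ j
  ... | yes refl = yes refl
  ... | no i≢j  = no λ { refl → i≢j refl }

  occurrences : Letter m → List (Letter m) → ℕ
  occurrences g []       = 0
  occurrences g (f ∷ ws) with f ≟ₗ g
  ... | yes _ = suc (occurrences g ws)
  ... | no _  = occurrences g ws

  occurrences-head : ∀ f ws → occurrences f (f ∷ ws) ≡ suc (occurrences f ws)
  occurrences-head f ws with f ≟ₗ f
  ... | yes _   = refl
  ... | no f≢f = ⊥-elim (f≢f refl)

  occurrences-other : ∀ {f g} ws → f ≢ g → occurrences g (f ∷ ws) ≡ occurrences g ws
  occurrences-other {f} {g} ws f≢g with f ≟ₗ g
  ... | yes f≡g = ⊥-elim (f≢g f≡g)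
  ... | no _    = refl

  occurrences-∉ : ∀ {g} ws → g ∉ ws → occurrences g ws ≡ 0
  occurrences-∉ []       _  = refl
  occurrences-∉ (f ∷ ws) g∉ =
    trans (occurrences-other ws (λ f≡g → g∉ (here (sym f≡g)))) (occurrences-∉ ws (g∉ ∘ there))

  occurrences-∈ : ∀ {g ws} → g ∈ ws → 1 ℕ.≤ occurrences g ws
  occurrences-∈ {g} {_ ∷ ws} (here refl) = subst (1 ℕ.≤_) (sym (occurrences-head g ws)) (s≤s z≤n)
  occurrences-∈ {g} {f ∷ ws} (there g∈) with f ≟ₗ g
  ... | yes _ = ℕP.m≤n⇒m≤1+n (occurrences-∈ g∈)
  ... | no _  = occurrences-∈ g∈

  netFlow : List (Letter m) → Flow m
  netFlow ws i = + occurrences (L i) ws - + occurrences (R i) ws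

  netFlow-head : ∀ f ws → Removes f (netFlow (f ∷ ws)) (netFlow ws)
  netFlow-head f ws = at f , off
    where
      add-left : ∀ p q → p - q ≡ ((+ 1 + p) - q) - + 1
      add-left = solve-∀
      add-right : ∀ p q → p - q ≡ (p - (+ 1 + q)) + + 1
      add-right = solve-∀
      at : ∀ g → netFlow ws (index g) ≡ netFlow (g ∷ ws) (index g) - delta g
      at (L i) = trans (add-left (+ occurrences (L i) ws) (+ occurrences (R i) ws))
                       (cong₂ (λ p q → (+ p - + q) - + 1)
                              (sym (occurrences-head (L i) ws)) (sym (occurrences-other {L i} {R i} ws λ ())))
      at (R i) = trans (add-right (+ occurrences (L i) ws) (+ occurrences (R i) ws))
                       (cong₂ (λ p q → (+ p - + q) + + 1)
                              (sym (occurrences-other {R i} {L i} ws λ ())) (sym (occurrences-head (R i) ws)))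
      off : ∀ j → j ≢ index f → netFlow ws j ≡ netFlow (f ∷ ws) j
      off j j≢ = cong₂ (λ p q → + p - + q)
                   (sym (occurrences-other {f} {L j} ws λ f≡ → j≢ (sym (cong index f≡))))
                   (sym (occurrences-other {f} {R j} ws λ f≡ → j≢ (sym (cong index f≡))))

path-source : ∀ {n m u w ws} → Path n m u w ws → IsVertex n m u
path-source (stop vu)     = vu
path-source (step vu _ _) = vu

path-balanced : ∀ {n m u ws} → Path n m u (zeroV m) ws → Balanced n u (netFlow ws)
path-balanced (stop _) c =
  ≈-reflexive (trans (VecP.lookup-replicate c (+ 0)) (sym (divergence-vanish (netFlow []) (λ _ → refl) c)))
path-balanced (step {u} {v} {f = f} {ws = ws} _ stp P) =
  balanced-backward {u = u} {v} stp (netFlow-head f ws) (path-balanced P)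

-- Applying a
-- leading letter to a balanced vertex gives again a vertex, balanced by the
-- flow with that unit removed; iterating reaches 0 in Σ|x_i| steps.

Towards : ∀ {m} → Letter m → ℤ → Set
Towards (L _) a = + 0 < a
Towards (R _) a = a < + 0

Agrees : ∀ {m} → Flow m → Letter m → Set
Agrees x f = Towards f (x (index f))

Extremal : ∀ {m} → Flow m → Letter m → Set
Extremal x (L i) = ∀ j → x j ≤ x i
Extremal x (R i) = ∀ j → x i ≤ x j

Leads : ∀ {m} → Flow m → Letter m → Set
Leads x f = Agrees x f × Extremal x f

argmax : ∀ {k} (x : Fin (suc k) → ℤ) → Σ[ i ∈ Fin (suc k) ] (∀ j → x j ≤ x i)
argmax {zero}  x = Fin.zero , λ { Fin.zero → ℤP.≤-refl }
argmax {suc k} x with argmax (x ∘ Fin.suc)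
... | i , max with x Fin.zero ℤP.≤? x (Fin.suc i)
...   | yes le = Fin.suc i , λ { Fin.zero → le ; (Fin.suc j) → max j }
...   | no  gt = Fin.zero , λ { Fin.zero → ℤP.≤-refl ; (Fin.suc j) → ℤP.≤-trans (max j) (ℤP.<⇒≤ (ℤP.≰⇒> gt)) }

argmin : ∀ {k} (x : Fin (suc k) → ℤ) → Σ[ i ∈ Fin (suc k) ] (∀ j → x i ≤ x j)
argmin x with argmax (-_ ∘ x)
... | i , max = i , λ j → ℤP.neg-cancel-≤ (max j)

leader-or-vanish : ∀ {m} (x : Flow m) → (Σ[ f ∈ Letter m ] Leads x f) ⊎ (∀ j → x j ≡ + 0)
leader-or-vanish {m} x = decide (argmax x) (argmin x)
  where
    decide : Σ[ i ∈ Fin (suc m) ] (∀ j → x j ≤ x i) → Σ[ i ∈ Fin (suc m) ] (∀ j → x i ≤ x j) →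
             (Σ[ f ∈ Letter m ] Leads x f) ⊎ (∀ j → x j ≡ + 0)
    decide (i , max) (i' , min) with + 0 ℤP.<? x i | x i' ℤP.<? + 0
    ... | yes pos | _       = inj₁ (L i , pos , max)
    ... | no _    | yes neg = inj₁ (R i' , neg , min)
    ... | no npos | no nneg = inj₂ λ j → ℤP.≤-antisym (ℤP.≤-trans (max j) (ℤP.≮⇒≥ npos))
                                                      (ℤP.≤-trans (ℤP.≮⇒≥ nneg) (min j))

towards-abs : ∀ {m} (f : Letter m) a → Towards f a → ∣ a ∣ ≡ suc ∣ a - delta f ∣
towards-abs (L _) (+ suc _)     _        = refl
towards-abs (L _) (+ zero)      (+<+ ())
towards-abs (L _) -[1+ _ ]      ()
towards-abs (R _) -[1+ zero ]   _        = refl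
towards-abs (R _) -[1+ suc _ ]  _        = refl
towards-abs (R _) (+ _)         (+<+ ())

towards-back : ∀ {m} (f g : Letter m) a → Towards f a → Towards g (a - delta f) → Towards g a
towards-back (L _) (L _) a             pos       _ = pos
towards-back (R _) (R _) a             neg       _ = neg
towards-back (L _) (R _) (+ suc _)     _         (+<+ ())
towards-back (L _) (R _) (+ zero)      (+<+ ())
towards-back (L _) (R _) -[1+ _ ]      ()
towards-back (R _) (L _) -[1+ zero ]   _         (+<+ ())
towards-back (R _) (L _) -[1+ suc _ ]  _         ()
towards-back (R _) (L _) (+ _)         (+<+ ())

removeUnit : ∀ {m} → Letter m → Flow m → Flow m
removeUnit f x j with j FinP.≟ index f
... | yes _ = x j - delta f
... | no _  = x j

removeUnit-removes : ∀ {m} (f : Letter m) x → Removes f x (removeUnit f x)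
removeUnit-removes f x = at , off
  where
    at : removeUnit f x (index f) ≡ x (index f) - delta f
    at with index f FinP.≟ index f
    ... | yes _   = refl
    ... | no i≢i = ⊥-elim (i≢i refl)
    off : ∀ j → j ≢ index f → removeUnit f x j ≡ x j
    off j j≢ with j FinP.≟ index f
    ... | yes j≡ = ⊥-elim (j≢ j≡)
    ... | no _   = refl

module _ {m : ℕ} {f : Letter m} {x x' : Flow m} (rem : Removes f x x') (agrees : Agrees x f) where

  removes-total : total (∣_∣ ∘ x) ≡ suc (total (∣_∣ ∘ x'))
  removes-total =
    total-step (∣_∣ ∘ x) (∣_∣ ∘ x') (index f)
               (trans (towards-abs f _ agrees) (cong (suc ∘ ∣_∣) (sym (proj₁ rem))))
               (λ j j≢ → cong ∣_∣ (sym (proj₂ rem j j≢)))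

  agrees-back : ∀ {g} → Agrees x' g → Agrees x g
  agrees-back {g} agrees' with index g FinP.≟ index f
  ... | yes same =
    subst (Towards g ∘ x) (sym same)
          (towards-back f g _ agrees (subst (Towards g) (proj₁ rem) (subst (Towards g ∘ x') same agrees')))
  ... | no other = subst (Towards g) (proj₂ rem (index g) other) agrees'

up-in-range : ∀ a → InRange a → a ≤ + 0 → InRange (a + + 1)
up-in-range -[1+ zero ]  _              _ = -≤+ , +≤+ z≤n
up-in-range -[1+ suc _ ] (-≤- () , _)   _
up-in-range (+ zero)     _              _ = -≤+ , +≤+ (s≤s z≤n)
up-in-range (+ suc _)    _              (+≤+ ())

down-in-range : ∀ a → InRange a → + 0 ≤ a → InRange (a - + 1)
down-in-range (+ zero)          _                  _ = -≤- z≤n , -≤+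
down-in-range (+ suc zero)      _                  _ = -≤+ , +≤+ z≤n
down-in-range (+ suc (suc _))   (_ , +≤+ (s≤s ())) _
down-in-range -[1+ _ ]          _                  ()

extremal-left : ∀ {m} {x : Flow m} f j → Extremal x f → InRange (x j - x (index f)) →
                InRange (x j - x (index f) + delta f)
extremal-left (L i) j ext r = up-in-range _ r (ℤP.i≤j⇒i-j≤0 (ext j))
extremal-left (R i) j ext r = down-in-range _ r (ℤP.i≤j⇒0≤j-i (ext j))

extremal-right : ∀ {m} {x : Flow m} f j → Extremal x f → InRange (x (index f) - x j) →
                 InRange (x (index f) - x j - delta f)
extremal-right (L i) j ext r = down-in-range _ r (ℤP.i≤j⇒0≤j-i (ext j))
extremal-right (R i) j ext r = up-in-range _ r (ℤP.i≤j⇒i-j≤0 (ext j))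

module _ {n m : ℕ} {u : Tuple m} {x : Flow m} (vu : IsVertex n m u) (bal : Balanced n u x) where

  -- a middle coordinate at an end of a leading letter's edge is a difference
  -- of two values of x, so moving it by the letter keeps it in {-1,0,1}
  leading-left-in-range : ∀ f → Extremal x f → ¬ IsOuter (inject₁ (index f)) →
                          InRange (lookup u (inject₁ (index f)) + delta f)
  leading-left-in-range f ext ¬o with divergence-left-middle x (index f) ¬o
  ... | j , div = subst (λ y → InRange (y + delta f)) (sym u≡) (extremal-left f j ext (subst InRange u≡ range))
    where
      u≡ : lookup u (inject₁ (index f)) ≡ x j - x (index f)
      u≡ = trans (≈-middle ¬o (bal (inject₁ (index f)))) div
      range : InRange (lookup u (inject₁ (index f)))
      range = proj₂ (vertex-admissible {u = u} vu (inject₁ (index f))) ¬o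

  leading-right-in-range : ∀ f → Extremal x f → ¬ IsOuter (Fin.suc (index f)) →
                           InRange (lookup u (Fin.suc (index f)) - delta f)
  leading-right-in-range f ext ¬o with divergence-right-middle x (index f) ¬o
  ... | j , div = subst (λ y → InRange (y - delta f)) (sym u≡) (extremal-right f j ext (subst InRange u≡ range))
    where
      u≡ : lookup u (Fin.suc (index f)) ≡ x (index f) - x j
      u≡ = trans (≈-middle ¬o (bal (Fin.suc (index f)))) div
      range : InRange (lookup u (Fin.suc (index f)))
      range = proj₂ (vertex-admissible {u = u} vu (Fin.suc (index f))) ¬o

module _ {n m : ℕ} {{_ : NonZero n}} where

  leading-step : ∀ {u : Tuple m} {x x' f} → IsVertex n m u → Balanced n u x → Leads x f → Removes f x x' →
                 Σ[ v ∈ Tuple m ] IsVertex n m v × Step n m u f v × Balanced n v x'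
  leading-step {u} {x} {x'} {f} vu bal (_ , ext) rem =
    v , admissible-vertex {u = v} admissible sum-divisible , stp , balanced-forward {u = u} {v} stp rem bal
    where
      i : Fin (suc m)
      i = index f
      δ : ℤ
      δ = delta f
      c₁ c₂ : Coord m
      c₁ = inject₁ i
      c₂ = Fin.suc i
      a₁ a₂ : ℤ
      a₁ = reduce c₁ (lookup u c₁ + δ)
      a₂ = reduce c₂ (lookup u c₂ - δ)
      v : Tuple m
      v = update₂ u c₁ c₂ a₁ a₂

      at₁ : lookup v c₁ ≡ a₁
      at₁ = update₂-at₁ u c₁ c₂ a₁ a₂ (inject₁≢suc i)
      at₂ : lookup v c₂ ≡ a₂
      at₂ = update₂-at₂ u c₁ c₂ a₁ a₂
      elsewhere : ∀ c → c ≢ c₁ → c ≢ c₂ → lookup v c ≡ lookup u c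
      elsewhere = update₂-elsewhere u c₁ c₂ a₁ a₂

      stp : Step n m u f v
      stp = (λ c ≢₁ ≢₂ → ≈-reflexive (elsewhere c ≢₁ ≢₂)) ,
            subst (λ a → CoordEq n c₁ a (lookup u c₁ + δ)) (sym at₁) (reduce-≈ c₁ _) ,
            subst (λ a → CoordEq n c₂ a (lookup u c₂ - δ)) (sym at₂) (reduce-≈ c₂ _)

      admissible : ∀ c → Admissible n c (lookup v c)
      admissible c with c FinP.≟ c₁ | c FinP.≟ c₂
      ... | yes refl | _        = subst (Admissible n c₁) (sym at₁)
                                        (reduce-admissible c₁ _ (leading-left-in-range {u = u} {x} vu bal f ext))
      ... | no _     | yes refl = subst (Admissible n c₂) (sym at₂)
                                        (reduce-admissible c₂ _ (leading-right-in-range {u = u} {x} vu bal f ext))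
      ... | no ≢₁    | no ≢₂    = subst (Admissible n c) (sym (elsewhere c ≢₁ ≢₂)) (vertex-admissible {u = u} vu c)

      sum-v : sumV v ≡ sumV u + (a₁ - (lookup u c₁ + δ)) + (a₂ - (lookup u c₂ - δ))
      sum-v = trans (update₂-sum u c₁ c₂ a₁ a₂ (inject₁≢suc i))
                    (regroup (sumV u) a₁ (lookup u c₁) a₂ (lookup u c₂) δ)
        where
          regroup : ∀ s a₁ w₁ a₂ w₂ d → s + (a₁ - w₁) + (a₂ - w₂) ≡ s + (a₁ - (w₁ + d)) + (a₂ - (w₂ - d))
          regroup = solve-∀

      sum-divisible : + n ∣ sumV v
      sum-divisible = subst (+ n ∣_) (sym sum-v)
        (∣m∣n⇒∣m+n (∣m∣n⇒∣m+n (∣ᵤ⇒∣ {i = sumV u} (proj₂ (proj₂ (proj₂ vu)))) (≈⇒∣ (reduce-≈ c₁ _)))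
                   (≈⇒∣ (reduce-≈ c₂ _)))

  Descent : Tuple m → Flow m → Set
  Descent u x = Σ[ ws ∈ List (Letter m) ]
                  Path n m u (zeroV m) ws × length ws ≡ total (∣_∣ ∘ x) × All (Agrees x) ws

  descent-vanish : ∀ {u x} → IsVertex n m u → Balanced n u x → (∀ j → x j ≡ + 0) → Descent u x
  descent-vanish {u} {x} vu bal vanish =
    [] , subst (λ w → Path n m u w []) at-zero (stop vu) , sym (total-vanish _ (cong ∣_∣ ∘ vanish)) , []
    where
      at-zero : u ≡ zeroV m
      at-zero = vertex-≈0 vu (λ c → ≈-trans (bal c) (≈-reflexive (divergence-vanish x vanish c)))

  greedy : ∀ N u x → IsVertex n m u → Balanced n u x → total (∣_∣ ∘ x) ≡ N → Descent u x
  greedy N u x vu bal size with leader-or-vanish x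
  greedy N       u x vu bal size | inj₂ vanish    = descent-vanish vu bal vanish
  greedy zero    u x vu bal size | inj₁ (f , lead) =
    ⊥-elim (ℕP.0≢1+n (trans (sym size) (removes-total (removeUnit-removes f x) (proj₁ lead))))
  greedy (suc N) u x vu bal size | inj₁ (f , lead) =
    let rem                     = removeUnit-removes f x
        shrink                  = removes-total rem (proj₁ lead)
        (v , vv , stp , bal')   = leading-step {u = u} vu bal lead rem
        (ws , P , len , agrees) = greedy N v (removeUnit f x) vv bal' (ℕP.suc-injective (trans (sym shrink) size))
    in f ∷ ws , step vu stp P , trans (cong suc len) (sym shrink) ,
       proj₁ lead ∷ All.map (agrees-back rem (proj₁ lead)) agrees

cancelling-gap : ∀ {a b} → 1 ℕ.≤ a → 1 ℕ.≤ b → 2 ℕ.+ ∣ + a - + b ∣ ℕ.≤ a ℕ.+ b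
cancelling-gap {suc a} {suc b} _ _ = begin
  2 ℕ.+ ∣ + suc a - + suc b ∣ ≡⟨ cong (λ y → 2 ℕ.+ ∣ y ∣) (drop-one (+ a) (+ b)) ⟩
  2 ℕ.+ ∣ + a - + b ∣         ≤⟨ s≤s (s≤s (ℤP.∣i-j∣≤∣i∣+∣j∣ (+ a) (+ b))) ⟩
  suc (suc (a ℕ.+ b))         ≡⟨ cong suc (sym (ℕP.+-suc a b)) ⟩
  suc a ℕ.+ suc b             ∎
  where
    open ℕP.≤-Reasoning
    drop-one : ∀ p q → (+ 1 + p) - (+ 1 + q) ≡ p - q
    drop-one = solve-∀

module _ {m : ℕ} where

  length-total : ∀ (ws : List (Letter m)) →
                 length ws ≡ total (λ i → occurrences (L i) ws ℕ.+ occurrences (R i) ws)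
  length-total []       = sym (total-vanish {suc m} _ (λ _ → refl))
  length-total (f ∷ ws) = trans (cong suc (length-total ws)) (sym (total-step _ _ (index f) (at f) off))
    where
      at : ∀ g → occurrences (L (index g)) (g ∷ ws) ℕ.+ occurrences (R (index g)) (g ∷ ws)
                 ≡ suc (occurrences (L (index g)) ws ℕ.+ occurrences (R (index g)) ws)
      at (L i) = cong₂ ℕ._+_ (occurrences-head (L i) ws) (occurrences-other {f = L i} {g = R i} ws λ ())
      at (R i) = trans (cong₂ ℕ._+_ (occurrences-other {f = R i} {g = L i} ws λ ()) (occurrences-head (R i) ws))
                       (ℕP.+-suc _ _)
      off : ∀ j → j ≢ index f → occurrences (L j) (f ∷ ws) ℕ.+ occurrences (R j) (f ∷ ws)
                                ≡ occurrences (L j) ws ℕ.+ occurrences (R j) ws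
      off j j≢ = cong₂ ℕ._+_ (occurrences-other {f = f} {g = L j} ws λ f≡ → j≢ (sym (cong index f≡)))
                             (occurrences-other {f = f} {g = R j} ws λ f≡ → j≢ (sym (cong index f≡)))

  length-gap : ∀ {i} ws → L i ∈ ws → R i ∈ ws → 2 ℕ.+ total (∣_∣ ∘ netFlow ws) ℕ.≤ length ws
  length-gap {i} ws L∈ R∈ =
    subst (2 ℕ.+ total (∣_∣ ∘ netFlow ws) ℕ.≤_) (sym (length-total ws))
          (total-gap _ _ i (λ j → ℤP.∣i-j∣≤∣i∣+∣j∣ (+ occurrences (L j) ws) (+ occurrences (R j) ws))
                           (cancelling-gap (occurrences-∈ L∈) (occurrences-∈ R∈)))

-- Walls: a word whose letters all agree with the flow of ws keeps every
-- wall of ws, since a missing letter forces the sign of the flow.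

  netFlow-without-L : ∀ {i} (ws : List (Letter m)) → L i ∉ ws → netFlow ws i ≤ + 0
  netFlow-without-L {i} ws L∉ =
    ℤP.i≤j⇒i-j≤0 (+≤+ (subst (ℕ._≤ occurrences (R i) ws) (sym (occurrences-∉ ws L∉)) z≤n))

  netFlow-without-R : ∀ {i} (ws : List (Letter m)) → R i ∉ ws → + 0 ≤ netFlow ws i
  netFlow-without-R {i} ws R∉ =
    ℤP.i≤j⇒0≤j-i (+≤+ (subst (ℕ._≤ occurrences (L i) ws) (sym (occurrences-∉ ws R∉)) z≤n))

  wall-transfer : ∀ {ws ws' : List (Letter m)} {p} → Wall m ws p → All (Agrees (netFlow ws)) ws' → Wall m ws' p
  wall-transfer {ws} (leftWall L∉) agree =
    leftWall (λ L∈ → ℤP.<⇒≱ (All.lookup agree L∈) (netFlow-without-L ws L∉))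
  wall-transfer {ws} (innerWall q L∉ R∉) agree =
    innerWall q (λ L∈ → ℤP.<⇒≱ (All.lookup agree L∈) (netFlow-without-L ws L∉))
                (λ R∈ → ℤP.<⇒≱ (All.lookup agree R∈) (netFlow-without-R ws R∉))
  wall-transfer {ws} (rightWall R∉) agree =
    rightWall (λ R∈ → ℤP.<⇒≱ (All.lookup agree R∈) (netFlow-without-R ws R∉))

lemma5p6 : (n m : ℕ) → 1 ℕ.≤ n → 1 ℕ.≤ m →
    (v : Tuple m) (ws : List (Letter m)) (P : Path n m v (zeroV m) ws) →
    IsPivotPath n m v ws P →
    (i : Fin (suc m)) → ¬ ((L i ∈ ws) × (R i ∈ ws))
lemma5p6 zero    _ () _ _ _ _ _ _ _
lemma5p6 (suc _) m _  _ v ws P (p , wall , shortest) i (L∈ , R∈)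
  with greedy _ v (netFlow ws) (path-source P) (path-balanced P) refl
... | ws' , P' , length≡ , agrees = ℕP.<-irrefl refl (begin-strict
  length ws'                         ≡⟨ length≡ ⟩
  total (∣_∣ ∘ netFlow ws)           <⟨ ℕP.m<n+m _ {2} (s≤s z≤n) ⟩
  2 ℕ.+ total (∣_∣ ∘ netFlow ws)     ≤⟨ length-gap ws L∈ R∈ ⟩
  length ws                          ≤⟨ shortest ws' P' (wall-transfer wall agrees) ⟩
  length ws'                         ∎)
  where open ℕP.≤-Reasoning
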